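{- Let $\mathfrak{Ba}$ be the countable atomless Boolean algebra with universe $B$, regarded as a Boolean ring, and let $f$ be an arbitrary non-linear term function of $\mathfrak{Ba}$. Then $\mathrm{Aut}(f)=\mathrm{Aut}(\mathfrak{Ba})$ or $\mathrm{Aut}(f)=\mathrm{Aut}(M)$, where $M(x,y,z)=xy+yz+zx$ is the median.
   Context: $\mathfrak{Ba}$ is viewed as a Boolean ring $(B,+,\cdot,0,1)$ with $+$ symmetric difference and $\cdot$ meet. Every $k$-ary term function can be written uniquely as a sum of monomials $\prod_{i\in S}x_i$ ($S\subseteq\{1,\dots,k\}$) with coefficients in $\{0,1\}$; it is non-linear if some monomial with $|S|\ge2$ occurs. For a term function $g$, $\mathrm{Aut}(g)$ is the group of permutations $\varphi$ of $B$ with $\varphi(g(a_1,\dots,a_k))=g(\varphi(a_1),\dots,\varphi(a_k))$ for all $a_i\in B$. -}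

module Defs where

open import Data.Nat using (ℕ; zero; suc; _≤_)
open import Data.Bool using (Bool; true; false; if_then_else_)
open import Data.Vec using (Vec; []; _∷_; map)
open import Data.List using (List; [_]; _++_; foldr)
import Data.List as L
open import Data.Product using (Σ; ∃; _×_; _,_)
open import Relation.Binary.PropositionalEquality using (_≡_)
open import Relation.Nullary using (¬_)
open import Function using (id)
open import Function.Definitions using (Surjective; Bijective)
open import Algebra.Structures using (IsCommutativeRing)

-- A Boolean ring: commutative ring (with propositional equality) in which
-- every element is idempotent; negation is the identity (x + x = 0).
record BooleanRing : Set₁ where
  infixl 6 _+_
  infixl 7 _·_
  field
    Carrier : Set
    _+_ _·_ : Carrier → Carrier → Carrier
    𝟘 𝟙 : Carrier
    isCommutativeRing : IsCommutativeRing _≡_ _+_ _·_ id 𝟘 𝟙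
    ·-idem : ∀ x → x · x ≡ x

module _ (R : BooleanRing) where
  open BooleanRing R

  -- nontrivial, countable, atomless (≤ in the Boolean algebra order: b ≤ a iff b·a = b)
  Nontrivial : Set
  Nontrivial = ¬ (𝟘 ≡ 𝟙)

  Countable : Set
  Countable = Σ (ℕ → Carrier) λ e → Surjective _≡_ _≡_ e

  Atomless : Set
  Atomless = ∀ a → ¬ (a ≡ 𝟘) → ∃ λ b → (b · a ≡ b) × ¬ (b ≡ 𝟘) × ¬ (b ≡ a)

  subsets : (k : ℕ) → List (Vec Bool k)
  subsets zero = [ [] ]
  subsets (suc k) = L.map (false ∷_) (subsets k) ++ L.map (true ∷_) (subsets k)

  monomial : ∀ {k} → Vec Bool k → Vec Carrier k → Carrier
  monomial [] [] = 𝟙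
  monomial (false ∷ S) (x ∷ xs) = monomial S xs
  monomial (true ∷ S) (x ∷ xs) = x · monomial S xs

  termFun : ∀ {k} → (Vec Bool k → Bool) → Vec Carrier k → Carrier
  termFun {k} c xs =
    foldr _+_ 𝟘 (L.map (λ S → if c S then monomial S xs else 𝟘) (subsets k))

  card : ∀ {k} → Vec Bool k → ℕ
  card [] = 0
  card (false ∷ S) = card S
  card (true ∷ S) = suc (card S)

  NonLinear : ∀ {k} → (Vec Bool k → Bool) → Set
  NonLinear c = ∃ λ S → (c S ≡ true) × (2 ≤ card S)

  -- φ ∈ Aut(g) (for a bijection φ): φ commutes with g
  Preserves : ∀ {k} → (Vec Carrier k → Carrier) → (Carrier → Carrier) → Set
  Preserves g φ = ∀ xs → φ (g xs) ≡ g (map φ xs)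

  IsAutomorphism : (Carrier → Carrier) → Set
  IsAutomorphism φ =
    (∀ x y → φ (x + y) ≡ φ x + φ y) × (∀ x y → φ (x · y) ≡ φ x · φ y)
    × (φ 𝟘 ≡ 𝟘) × (φ 𝟙 ≡ 𝟙)

  median : Vec Carrier 3 → Carrier
  median (x ∷ y ∷ z ∷ []) = x · y + y · z + z · x

  -- equality of automorphism groups as subsets of Sym(B)
  AutEq : (P Q : (Carrier → Carrier) → Set) → Set
  AutEq P Q = ∀ φ → Bijective _≡_ _≡_ φ → (P φ → Q φ) × (Q φ → P φ)

module Submission where

-- The argument works in
-- every Boolean ring.
--
-- TT n, truth tables as iterated products of the two-element ring,
--    is the free Boolean ring on n generators, so every operation commuting
--    with all homomorphisms (a term function, a ring expression, ...) is the
--    evaluation of its truth table.  A bijection preserving · or ∨ is an automorphism; if φ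
--    preserves M then x ↦ φ x + φ 𝟘 is an automorphism.
-- 3. Non-linearity.  f has a ternary minor g with nonzero xy-difference; for all
--    128 such tables a term over g computing ·, ∨ or M is listed and checked by
--    evaluation.  Hence every bijection preserving f preserves M.
-- 4. Dichotomy.  A self-dual f commutes with translations, so M-preserving
--    bijections preserve f.  Otherwise f(b + a) = f(b) for some Boolean point b,
--    forcing φ 𝟘 = 𝟘 whenever φ preserves f and M, i.e. φ is an automorphism.

open import Defs
open import Level using (0ℓ)
open import Data.Nat using (ℕ; zero; suc; _≤_; s≤s)
open import Data.Bool using (Bool; true; false; if_then_else_; _∧_; _xor_; not)
import Data.Bool.Properties as Bool
open import Data.Bool.Properties
  using (xor-∧-commutativeRing; ∧-idem; xor-assoc; xor-comm; xor-same; xor-identityʳ; true-xor)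
open import Data.Fin using (Fin; zero; suc)
open import Data.List using (List; []; _∷_; _++_; foldr)
import Data.List as L
import Data.List.Properties as L
open import Data.Vec using (Vec; []; _∷_; map; lookup; replicate)
import Data.Vec.Properties as V
open import Data.Product using (_×_; _,_; proj₁; proj₂; ∃)
import Data.Product.Properties as Product
open import Data.Sum using (_⊎_; inj₁; inj₂)
open import Relation.Nullary using (Dec; yes)
open import Relation.Nullary.Decidable using (isYes)
open import Relation.Binary.Definitions using (DecidableEquality)
open import Relation.Binary.PropositionalEquality
open import Function using (_∘_)
open import Function.Definitions using (Bijective)
import Function.Construct.Composition as Composition
open import Algebra.Bundles using (CommutativeRing)
open import Algebra.Structures using (IsCommutativeRing)
import Algebra.Properties.CommutativeSemigroup as CommutativeSemigroupProperties

module BooleanRingProperties (R : BooleanRing) where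
  open BooleanRing R public
  open IsCommutativeRing isCommutativeRing public
    using ( +-assoc; +-comm; +-identityˡ; +-identityʳ; *-assoc; *-comm
          ; *-identityˡ; *-identityʳ; distribˡ; distribʳ; zeroˡ; zeroʳ )

  private
    ring : CommutativeRing 0ℓ 0ℓ
    ring = record { isCommutativeRing = isCommutativeRing }
    open CommutativeSemigroupProperties (CommutativeRing.+-commutativeSemigroup ring)
      using () renaming (interchange to +-interchange)
    open CommutativeSemigroupProperties (CommutativeRing.*-commutativeSemigroup ring)
      using (x∙yz≈y∙xz; xy∙z≈y∙xz)

  +-self : ∀ x → x + x ≡ 𝟘
  +-self = IsCommutativeRing.-‿inverseʳ isCommutativeRing

  +-cancel : ∀ u a → (u + a) + a ≡ u
  +-cancel u a = trans (+-assoc u a a) (trans (cong (u +_) (+-self a)) (+-identityʳ u))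

  infixl 8 _ᶜ
  _ᶜ : Carrier → Carrier
  x ᶜ = x + 𝟙

  ·-complement : ∀ x → x · x ᶜ ≡ 𝟘
  ·-complement x = trans (distribˡ x x 𝟙) (trans (cong₂ _+_ (·-idem x) (*-identityʳ x)) (+-self x))

  complement-· : ∀ x → x ᶜ · x ≡ 𝟘
  complement-· x = trans (*-comm (x ᶜ) x) (·-complement x)

  +-complement : ∀ x → x + x ᶜ ≡ 𝟙
  +-complement x = trans (sym (+-assoc x x 𝟙)) (trans (cong (_+ 𝟙) (+-self x)) (+-identityˡ 𝟙))

  disjoint⇒below-complement : ∀ y x → y · x ≡ 𝟘 → y · x ᶜ ≡ y
  disjoint⇒below-complement y x yx≡𝟘 =
    trans (distribˡ y x 𝟙) (trans (cong₂ _+_ yx≡𝟘 (*-identityʳ y)) (+-identityˡ y))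

  -- "if x then a else b" inside the ring: the Shannon expansion step.
  select : Carrier → Carrier → Carrier → Carrier
  select x a b = x · a + x ᶜ · b

  select-same : ∀ x a → select x a a ≡ a
  select-same x a = trans (sym (distribʳ a x (x ᶜ))) (trans (cong (_· a) (+-complement x)) (*-identityˡ a))

  select-𝟙 : ∀ a b → select 𝟙 a b ≡ a
  select-𝟙 a b = begin
    𝟙 · a + (𝟙 + 𝟙) · b ≡⟨ cong₂ _+_ (*-identityˡ a) (cong (_· b) (+-self 𝟙)) ⟩
    a + 𝟘 · b           ≡⟨ cong (a +_) (zeroˡ b) ⟩
    a + 𝟘               ≡⟨ +-identityʳ a ⟩
    a                   ∎
    where open ≡-Reasoning

  select-𝟘 : ∀ a b → select 𝟘 a b ≡ b
  select-𝟘 a b = begin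
    𝟘 · a + (𝟘 + 𝟙) · b ≡⟨ cong₂ _+_ (zeroˡ a) (cong (_· b) (+-identityˡ 𝟙)) ⟩
    𝟘 + 𝟙 · b           ≡⟨ trans (+-identityˡ _) (*-identityˡ b) ⟩
    b                   ∎
    where open ≡-Reasoning

  select-+ : ∀ x a b c d → select x a b + select x c d ≡ select x (a + c) (b + d)
  select-+ x a b c d =
    trans (+-interchange (x · a) (x ᶜ · b) (x · c) (x ᶜ · d))
          (sym (cong₂ _+_ (distribˡ x a c) (distribˡ (x ᶜ) b d)))

  select-left : ∀ x a b → x · select x a b ≡ x · a
  select-left x a b = begin
    x · (x · a + x ᶜ · b)           ≡⟨ distribˡ x _ _ ⟩
    x · (x · a) + x · (x ᶜ · b)     ≡⟨ cong₂ _+_ (sym (*-assoc x x a)) (sym (*-assoc x (x ᶜ) b)) ⟩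
    (x · x) · a + (x · x ᶜ) · b     ≡⟨ cong₂ _+_ (cong (_· a) (·-idem x)) (cong (_· b) (·-complement x)) ⟩
    x · a + 𝟘 · b                   ≡⟨ trans (cong (x · a +_) (zeroˡ b)) (+-identityʳ _) ⟩
    x · a                           ∎
    where open ≡-Reasoning

  select-right : ∀ x a b → x ᶜ · select x a b ≡ x ᶜ · b
  select-right x a b = begin
    x ᶜ · (x · a + x ᶜ · b)             ≡⟨ distribˡ (x ᶜ) _ _ ⟩
    x ᶜ · (x · a) + x ᶜ · (x ᶜ · b)     ≡⟨ cong₂ _+_ (sym (*-assoc (x ᶜ) x a)) (sym (*-assoc (x ᶜ) (x ᶜ) b)) ⟩
    (x ᶜ · x) · a + (x ᶜ · x ᶜ) · b     ≡⟨ cong₂ _+_ (cong (_· a) (complement-· x)) (cong (_· b) (·-idem (x ᶜ))) ⟩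
    𝟘 · a + x ᶜ · b                     ≡⟨ trans (cong (_+ x ᶜ · b) (zeroˡ a)) (+-identityˡ _) ⟩
    x ᶜ · b                             ∎
    where open ≡-Reasoning

  select-· : ∀ x a b c d → select x a b · select x c d ≡ select x (a · c) (b · d)
  select-· x a b c d = begin
    (x · a + x ᶜ · b) · s                 ≡⟨ distribʳ s (x · a) (x ᶜ · b) ⟩
    (x · a) · s + (x ᶜ · b) · s           ≡⟨ cong₂ _+_ (xy∙z≈y∙xz x a s) (xy∙z≈y∙xz (x ᶜ) b s) ⟩
    a · (x · s) + b · (x ᶜ · s)           ≡⟨ cong₂ _+_ (cong (a ·_) (select-left x c d)) (cong (b ·_) (select-right x c d)) ⟩
    a · (x · c) + b · (x ᶜ · d)           ≡⟨ cong₂ _+_ (x∙yz≈y∙xz a x c) (x∙yz≈y∙xz b (x ᶜ) d) ⟩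
    x · (a · c) + x ᶜ · (b · d)           ∎
    where
    open ≡-Reasoning
    s = select x c d

record IsHomomorphism (R S : BooleanRing)
                      (h : BooleanRing.Carrier R → BooleanRing.Carrier S) : Set where
  private
    module R = BooleanRing R
    module S = BooleanRing S
  field
    hom-+ : ∀ x y → h (x R.+ y) ≡ h x S.+ h y
    hom-· : ∀ x y → h (x R.· y) ≡ h x S.· h y
    hom-𝟘 : h R.𝟘 ≡ S.𝟘
    hom-𝟙 : h R.𝟙 ≡ S.𝟙

automorphism⇒endomorphism : ∀ {R φ} → IsAutomorphism R φ → IsHomomorphism R R φ
automorphism⇒endomorphism (φ-+ , φ-· , φ-𝟘 , φ-𝟙) = record { hom-+ = φ-+ ; hom-· = φ-· ; hom-𝟘 = φ-𝟘 ; hom-𝟙 = φ-𝟙 }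

endomorphism⇒automorphism : ∀ {R φ} → IsHomomorphism R R φ → IsAutomorphism R φ
endomorphism⇒automorphism H = hom-+ , hom-· , hom-𝟘 , hom-𝟙
  where open IsHomomorphism H

module Homomorphism {R S : BooleanRing} {h : BooleanRing.Carrier R → BooleanRing.Carrier S}
                    (H : IsHomomorphism R S h) where
  open IsHomomorphism H public
  private
    module R = BooleanRingProperties R
    module S = BooleanRingProperties S

  hom-select : ∀ x a b → h (R.select x a b) ≡ S.select (h x) (h a) (h b)
  hom-select x a b = trans (hom-+ _ _) (cong₂ S._+_ (hom-· x a)
    (trans (hom-· _ b) (cong (S._· h b) (trans (hom-+ x R.𝟙) (cong (h x S.+_) hom-𝟙)))))

  subsets-independent : ∀ k → subsets R k ≡ subsets S k
  subsets-independent zero = refl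
  subsets-independent (suc k) rewrite subsets-independent k = refl

  hom-monomial : ∀ {k} (T : Vec Bool k) xs → h (monomial R T xs) ≡ monomial S T (map h xs)
  hom-monomial [] [] = hom-𝟙
  hom-monomial (false ∷ T) (x ∷ xs) = hom-monomial T xs
  hom-monomial (true ∷ T) (x ∷ xs) = trans (hom-· x _) (cong (h x S.·_) (hom-monomial T xs))

  hom-sum : ∀ (l : List R.Carrier) → h (foldr R._+_ R.𝟘 l) ≡ foldr S._+_ S.𝟘 (L.map h l)
  hom-sum [] = hom-𝟘
  hom-sum (x ∷ l) = trans (hom-+ x _) (cong (h x S.+_) (hom-sum l))

  hom-termFun : ∀ {k} (c : Vec Bool k → Bool) xs → h (termFun R c xs) ≡ termFun S c (map h xs)
  hom-termFun {k} c xs = begin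
    h (foldr R._+_ R.𝟘 (L.map termR (subsets R k)))     ≡⟨ hom-sum (L.map termR (subsets R k)) ⟩
    foldr S._+_ S.𝟘 (L.map h (L.map termR (subsets R k))) ≡⟨ cong (foldr S._+_ S.𝟘) (sym (L.map-∘ (subsets R k))) ⟩
    foldr S._+_ S.𝟘 (L.map (h ∘ termR) (subsets R k))     ≡⟨ cong (foldr S._+_ S.𝟘) (L.map-cong hom-term (subsets R k)) ⟩
    foldr S._+_ S.𝟘 (L.map termS (subsets R k))           ≡⟨ cong (λ l → foldr S._+_ S.𝟘 (L.map termS l)) (subsets-independent k) ⟩
    foldr S._+_ S.𝟘 (L.map termS (subsets S k))           ∎
    where
    open ≡-Reasoning
    termR = λ T → if c T then monomial R T xs else R.𝟘
    termS = λ T → if c T then monomial S T (map h xs) else S.𝟘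
    hom-term : ∀ T → h (termR T) ≡ termS T
    hom-term T with c T
    ... | true = hom-monomial T xs
    ... | false = hom-𝟘

module TermFunctionExpansion (R : BooleanRing) where
  open BooleanRingProperties R

  private
    sum : List Carrier → Carrier
    sum = foldr _+_ 𝟘

    sum-++ : ∀ l₁ l₂ → sum (l₁ ++ l₂) ≡ sum l₁ + sum l₂
    sum-++ [] l₂ = sym (+-identityˡ _)
    sum-++ (a ∷ l₁) l₂ = trans (cong (a +_) (sum-++ l₁ l₂)) (sym (+-assoc a _ _))

    sum-scale : ∀ x l → sum (L.map (x ·_) l) ≡ x · sum l
    sum-scale x [] = sym (zeroʳ x)
    sum-scale x (a ∷ l) = trans (cong (x · a +_) (sum-scale x l)) (sym (distribˡ x a _))

  termFun-step : ∀ {k} (c : Vec Bool (suc k) → Bool) x xs →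
    termFun R c (x ∷ xs) ≡ termFun R (c ∘ (false ∷_)) xs + x · termFun R (c ∘ (true ∷_)) xs
  termFun-step {k} c x xs = begin
    sum (L.map term (L.map (false ∷_) Ts ++ L.map (true ∷_) Ts))
      ≡⟨ cong sum (L.map-++ term (L.map (false ∷_) Ts) _) ⟩
    sum (L.map term (L.map (false ∷_) Ts) ++ L.map term (L.map (true ∷_) Ts))
      ≡⟨ sum-++ (L.map term (L.map (false ∷_) Ts)) _ ⟩
    sum (L.map term (L.map (false ∷_) Ts)) + sum (L.map term (L.map (true ∷_) Ts))
      ≡⟨ cong₂ _+_ (cong sum (sym (L.map-∘ Ts))) (cong sum (sym (L.map-∘ Ts))) ⟩
    termFun R (c ∘ (false ∷_)) xs + sum (L.map (term ∘ (true ∷_)) Ts)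
      ≡⟨ cong (λ l → termFun R (c ∘ (false ∷_)) xs + sum l) (trans (L.map-cong scaled Ts) (L.map-∘ Ts)) ⟩
    termFun R (c ∘ (false ∷_)) xs + sum (L.map (x ·_) (L.map term₁ Ts))
      ≡⟨ cong (termFun R (c ∘ (false ∷_)) xs +_) (sum-scale x (L.map term₁ Ts)) ⟩
    termFun R (c ∘ (false ∷_)) xs + x · termFun R (c ∘ (true ∷_)) xs ∎
    where
    open ≡-Reasoning
    Ts = subsets R k
    term = λ T → if c T then monomial R T (x ∷ xs) else 𝟘
    term₁ = λ T → if c (true ∷ T) then monomial R T xs else 𝟘
    scaled : ∀ T → term (true ∷ T) ≡ x · term₁ T
    scaled T with c (true ∷ T)
    ... | true = refl
    ... | false = sym (zeroʳ x)

𝔹 : BooleanRing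
𝔹 = record
  { Carrier = Bool ; _+_ = _xor_ ; _·_ = _∧_ ; 𝟘 = false ; 𝟙 = true
  ; isCommutativeRing = CommutativeRing.isCommutativeRing xor-∧-commutativeRing
  ; ·-idem = ∧-idem }

infixr 2 _⊗_
_⊗_ : BooleanRing → BooleanRing → BooleanRing
R ⊗ S = record
  { Carrier = R.Carrier × S.Carrier
  ; _+_ = λ x y → proj₁ x R.+ proj₁ y , proj₂ x S.+ proj₂ y
  ; _·_ = λ x y → proj₁ x R.· proj₁ y , proj₂ x S.· proj₂ y
  ; 𝟘 = R.𝟘 , S.𝟘
  ; 𝟙 = R.𝟙 , S.𝟙
  ; isCommutativeRing = record
    { isRing = record
      { +-isAbelianGroup = record
        { isGroup = record
          { isMonoid = record
            { isSemigroup = record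
              { isMagma = record { isEquivalence = isEquivalence ; ∙-cong = λ p q → cong₂ _ p q }
              ; assoc = λ x y z → pair (R.+-assoc _ _ _) (S.+-assoc _ _ _) }
            ; identity = (λ x → pair (R.+-identityˡ _) (S.+-identityˡ _))
                       , (λ x → pair (R.+-identityʳ _) (S.+-identityʳ _)) }
          ; inverse = (λ x → pair (R.-‿inverseˡ _) (S.-‿inverseˡ _))
                    , (λ x → pair (R.-‿inverseʳ _) (S.-‿inverseʳ _))
          ; ⁻¹-cong = λ p → p }
        ; comm = λ x y → pair (R.+-comm _ _) (S.+-comm _ _) }
      ; *-cong = λ p q → cong₂ _ p q
      ; *-assoc = λ x y z → pair (R.*-assoc _ _ _) (S.*-assoc _ _ _)
      ; *-identity = (λ x → pair (R.*-identityˡ _) (S.*-identityˡ _))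
                   , (λ x → pair (R.*-identityʳ _) (S.*-identityʳ _))
      ; distrib = (λ x y z → pair (R.distribˡ _ _ _) (S.distribˡ _ _ _))
                , (λ x y z → pair (R.distribʳ _ _ _) (S.distribʳ _ _ _)) }
    ; *-comm = λ x y → pair (R.*-comm _ _) (S.*-comm _ _) }
  ; ·-idem = λ x → pair (R.·-idem _) (S.·-idem _) }
  where
  module R where
    open BooleanRing R public
    open IsCommutativeRing isCommutativeRing public
  module S where
    open BooleanRing S public
    open IsCommutativeRing isCommutativeRing public
  pair : ∀ {A B : Set} {a a' : A} {b b' : B} → a ≡ a' → b ≡ b' → (a , b) ≡ (a' , b')
  pair = cong₂ _,_

-- Truth tables of n-ary Boolean functions: TT (n+1) = TT n ⊗ TT n, where a
-- table (p₀ , p₁) lists the values with first argument 0 and 1 respectively.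
-- TT n is the free Boolean ring on n generators.
TT : ℕ → BooleanRing
TT zero = 𝔹
TT (suc n) = TT n ⊗ TT n

Table : ℕ → Set
Table n = BooleanRing.Carrier (TT n)

vars : ∀ n → Vec (Table n) n
vars zero = []
vars (suc n) = (BooleanRing.𝟘 (TT n) , BooleanRing.𝟙 (TT n)) ∷ map (λ p → p , p) (vars n)

-- The n-ary operation of R with truth table p, by iterated Shannon expansion.
eval : ∀ (R : BooleanRing) {n} → Table n → Vec (BooleanRing.Carrier R) n → BooleanRing.Carrier R
eval R {zero} b [] = if b then BooleanRing.𝟙 R else BooleanRing.𝟘 R
eval R {suc n} (p₀ , p₁) (x ∷ xs) = BooleanRingProperties.select R x (eval R p₁ xs) (eval R p₀ xs)

module _ (R : BooleanRing) where
  open BooleanRingProperties R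

  eval-hom : ∀ {n} (xs : Vec Carrier n) → IsHomomorphism (TT n) R (λ p → eval R p xs)
  eval-hom [] = record { hom-+ = eval-+ ; hom-· = eval-· ; hom-𝟘 = refl ; hom-𝟙 = refl }
    where
    eval-+ : ∀ a b → eval R (a xor b) [] ≡ eval R a [] + eval R b []
    eval-+ true true = sym (+-self 𝟙)
    eval-+ true false = sym (+-identityʳ 𝟙)
    eval-+ false true = sym (+-identityˡ 𝟙)
    eval-+ false false = sym (+-identityʳ 𝟘)
    eval-· : ∀ a b → eval R (a ∧ b) [] ≡ eval R a [] · eval R b []
    eval-· true true = sym (·-idem 𝟙)
    eval-· true false = sym (zeroʳ 𝟙)
    eval-· false b = sym (zeroˡ _)
  eval-hom {suc n} (x ∷ xs) = record
    { hom-+ = λ p q → trans (cong₂ (select x) (hom-+ _ _) (hom-+ _ _)) (sym (select-+ x _ _ _ _))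
    ; hom-· = λ p q → trans (cong₂ (select x) (hom-· _ _) (hom-· _ _)) (sym (select-· x _ _ _ _))
    ; hom-𝟘 = trans (cong₂ (select x) hom-𝟘 hom-𝟘) (select-same x 𝟘)
    ; hom-𝟙 = trans (cong₂ (select x) hom-𝟙 hom-𝟙) (select-same x 𝟙) }
    where open IsHomomorphism (eval-hom xs)

  eval-vars : ∀ {n} (xs : Vec Carrier n) → map (λ p → eval R p xs) (vars n) ≡ xs
  eval-vars [] = refl
  eval-vars {suc n} (x ∷ xs) = cong₂ _∷_ eval-first (trans (sym (V.map-∘ _ _ (vars n)))
    (trans (V.map-cong (λ p → select-same x (eval R p xs)) (vars n)) (eval-vars xs)))
    where
    open IsHomomorphism (eval-hom xs)
    eval-first : select x (eval R (BooleanRing.𝟙 (TT n)) xs) (eval R (BooleanRing.𝟘 (TT n)) xs) ≡ x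
    eval-first = trans (cong₂ (select x) hom-𝟙 hom-𝟘)
      (trans (cong₂ _+_ (*-identityʳ x) (zeroʳ (x ᶜ))) (+-identityʳ x))

eval-natural : ∀ {R S h} → IsHomomorphism R S h →
  ∀ {n} (p : Table n) (xs : Vec _ n) → h (eval R p xs) ≡ eval S p (map h xs)
eval-natural H {zero} true [] = IsHomomorphism.hom-𝟙 H
eval-natural H {zero} false [] = IsHomomorphism.hom-𝟘 H
eval-natural {S = S} {h} H {suc n} (p₀ , p₁) (x ∷ xs) =
  trans (Homomorphism.hom-select H x _ _)
        (cong₂ (BooleanRingProperties.select S (h x)) (eval-natural H p₁ xs) (eval-natural H p₀ xs))

table-ext : ∀ {n} (p q : Table n) → (∀ (bs : Vec Bool n) → eval 𝔹 p bs ≡ eval 𝔹 q bs) → p ≡ q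
table-ext {zero} true true agree = refl
table-ext {zero} true false agree = agree []
table-ext {zero} false true agree = agree []
table-ext {zero} false false agree = refl
table-ext {suc n} (p₀ , p₁) (q₀ , q₁) agree = cong₂ _,_
  (table-ext {n} p₀ q₀ λ bs → trans (sym (select-𝟘 (eval 𝔹 p₁ bs) _))
                                    (trans (agree (false ∷ bs)) (select-𝟘 (eval 𝔹 q₁ bs) _)))
  (table-ext {n} p₁ q₁ λ bs → trans (sym (select-𝟙 _ (eval 𝔹 p₀ bs)))
                                    (trans (agree (true ∷ bs)) (select-𝟙 _ (eval 𝔹 q₀ bs))))
  where open BooleanRingProperties 𝔹

record NaturalOperation (m : ℕ) : Set₁ where
  field
    op : (R : BooleanRing) → Vec (BooleanRing.Carrier R) m → BooleanRing.Carrier R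
    natural : ∀ {R S h} → IsHomomorphism R S h → ∀ xs → h (op R xs) ≡ op S (map h xs)

  -- Its truth table: the value at the generic point of the free Boolean ring.
  table : Table m
  table = op (TT m) (vars m)

  represented : ∀ R xs → op R xs ≡ eval R table xs
  represented R xs = trans (cong (op R) (sym (eval-vars R xs))) (sym (natural (eval-hom R xs) (vars m)))

open NaturalOperation

same-table⇒equal : ∀ {m} (f g : NaturalOperation m) → table f ≡ table g →
  ∀ R xs → op f R xs ≡ op g R xs
same-table⇒equal f g f≡g R xs =
  trans (represented f R xs) (trans (cong (λ p → eval R p xs) f≡g) (sym (represented g R xs)))

agree-on-𝔹⇒equal : ∀ {m} (f g : NaturalOperation m) → (∀ bs → op f 𝔹 bs ≡ op g 𝔹 bs) →
  ∀ R xs → op f R xs ≡ op g R xs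
agree-on-𝔹⇒equal f g agree = same-table⇒equal f g (table-ext (table f) (table g)
  λ bs → trans (sym (represented f 𝔹 bs)) (trans (agree bs) (represented g 𝔹 bs)))

shannon : ∀ {m} (f : NaturalOperation (suc m)) R a xs →
  op f R (a ∷ xs) ≡ BooleanRingProperties.select R a (op f R (BooleanRing.𝟙 R ∷ xs)) (op f R (BooleanRing.𝟘 R ∷ xs))
shannon f R a xs = begin
  op f R (a ∷ xs)                         ≡⟨ represented f R (a ∷ xs) ⟩
  select a (eval R t₁ xs) (eval R t₀ xs)  ≡⟨ cong₂ (select a) (sym at-𝟙) (sym at-𝟘) ⟩
  select a (op f R (𝟙 ∷ xs)) (op f R (𝟘 ∷ xs)) ∎
  where
  open ≡-Reasoning
  open BooleanRingProperties R
  t₀ = proj₁ (table f)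
  t₁ = proj₂ (table f)
  at-𝟙 : op f R (𝟙 ∷ xs) ≡ eval R t₁ xs
  at-𝟙 = trans (represented f R (𝟙 ∷ xs)) (select-𝟙 _ _)
  at-𝟘 : op f R (𝟘 ∷ xs) ≡ eval R t₀ xs
  at-𝟘 = trans (represented f R (𝟘 ∷ xs)) (select-𝟘 _ _)

infixl 6 _:+_
infixl 7 _:·_
data Exp (m : ℕ) : Set where
  ′_ : Fin m → Exp m
  _:+_ _:·_ : Exp m → Exp m → Exp m
  :𝟘 :𝟙 : Exp m

⟦_⟧ : ∀ {m} → Exp m → (R : BooleanRing) → Vec (BooleanRing.Carrier R) m → BooleanRing.Carrier R
⟦ ′ j ⟧ R xs = lookup xs j
⟦ e₁ :+ e₂ ⟧ R xs = BooleanRing._+_ R (⟦ e₁ ⟧ R xs) (⟦ e₂ ⟧ R xs)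
⟦ e₁ :· e₂ ⟧ R xs = BooleanRing._·_ R (⟦ e₁ ⟧ R xs) (⟦ e₂ ⟧ R xs)
⟦ :𝟘 ⟧ R xs = BooleanRing.𝟘 R
⟦ :𝟙 ⟧ R xs = BooleanRing.𝟙 R

expressionOp : ∀ {m} → Exp m → NaturalOperation m
expressionOp e = record { op = ⟦ e ⟧ ; natural = λ H → natural-⟦ e ⟧ H }
  where
  natural-⟦_⟧ : ∀ {m} (e : Exp m) {R S h} → IsHomomorphism R S h → ∀ xs → h (⟦ e ⟧ R xs) ≡ ⟦ e ⟧ S (map h xs)
  natural-⟦ ′ j ⟧ H xs = sym (V.lookup-map j _ xs)
  natural-⟦ e₁ :+ e₂ ⟧ {S = S} H xs =
    trans (IsHomomorphism.hom-+ H _ _) (cong₂ (BooleanRing._+_ S) (natural-⟦ e₁ ⟧ H xs) (natural-⟦ e₂ ⟧ H xs))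
  natural-⟦ e₁ :· e₂ ⟧ {S = S} H xs =
    trans (IsHomomorphism.hom-· H _ _) (cong₂ (BooleanRing._·_ S) (natural-⟦ e₁ ⟧ H xs) (natural-⟦ e₂ ⟧ H xs))
  natural-⟦ :𝟘 ⟧ H xs = IsHomomorphism.hom-𝟘 H
  natural-⟦ :𝟙 ⟧ H xs = IsHomomorphism.hom-𝟙 H

-- A decision procedure for Boolean-ring identities: compare truth tables.
solve : ∀ {m} (e₁ e₂ : Exp m) → ⟦ e₁ ⟧ (TT m) (vars m) ≡ ⟦ e₂ ⟧ (TT m) (vars m) →
  ∀ R xs → ⟦ e₁ ⟧ R xs ≡ ⟦ e₂ ⟧ R xs
solve e₁ e₂ = same-table⇒equal (expressionOp e₁) (expressionOp e₂)

X : ∀ {m} → Exp (suc m)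
X = ′ zero

Y : ∀ {m} → Exp (suc (suc m))
Y = ′ suc zero

Z : ∀ {m} → Exp (suc (suc (suc m)))
Z = ′ suc (suc zero)

meetExp joinExp medianExp : Exp 3
meetExp = X :· Y
joinExp = X :+ Y :+ X :· Y
medianExp = X :· Y :+ Y :· Z :+ Z :· X

involution⇒bijective : ∀ {A : Set} (t : A → A) → (∀ x → t (t x) ≡ x) → Bijective _≡_ _≡_ t
involution⇒bijective t t-inv =
  (λ {x} {y} tx≡ty → trans (sym (t-inv x)) (trans (cong t tx≡ty) (t-inv y))) ,
  (λ y → t y , λ z≡ty → trans (cong t z≡ty) (t-inv y))

module Recognition (R : BooleanRing) where
  open BooleanRingProperties R

  Bij : (Carrier → Carrier) → Set
  Bij φ = Bijective _≡_ _≡_ φ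

  module _ {φ : Carrier → Carrier} (φ-bij : Bij φ) where
    preimage : Carrier → Carrier
    preimage y = proj₁ (proj₂ φ-bij y)

    φ-preimage : ∀ y → φ (preimage y) ≡ y
    φ-preimage y = proj₂ (proj₂ φ-bij y) refl

  ᶜ-involutive : ∀ x → x ᶜ ᶜ ≡ x
  ᶜ-involutive x = +-cancel x 𝟙

  endomorphism-ext : ∀ {φ ψ} → (∀ x → φ x ≡ ψ x) → IsHomomorphism R R ψ → IsHomomorphism R R φ
  endomorphism-ext {φ} {ψ} φ≗ψ H = record
    { hom-+ = λ x y → trans (φ≗ψ _) (trans (hom-+ x y) (sym (cong₂ _+_ (φ≗ψ x) (φ≗ψ y))))
    ; hom-· = λ x y → trans (φ≗ψ _) (trans (hom-· x y) (sym (cong₂ _·_ (φ≗ψ x) (φ≗ψ y))))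
    ; hom-𝟘 = trans (φ≗ψ 𝟘) hom-𝟘
    ; hom-𝟙 = trans (φ≗ψ 𝟙) hom-𝟙 }
    where open IsHomomorphism H

  translation-bijective : ∀ a → Bij (_+ a)
  translation-bijective a = involution⇒bijective (_+ a) (λ x → +-cancel x a)

  -- Bijections preserving · fix 𝟘, 𝟙 and complements, and then also preserve +,
  -- since x + y = ((x·yᶜ)ᶜ·(y·xᶜ)ᶜ)ᶜ.
  module ·-Preserving {φ : Carrier → Carrier} (φ-bij : Bij φ)
                      (φ-· : ∀ x y → φ (x · y) ≡ φ x · φ y) where

    φ-𝟙 : φ 𝟙 ≡ 𝟙
    φ-𝟙 = sym (begin
      𝟙               ≡⟨ sym (φ-preimage φ-bij 𝟙) ⟩
      φ w             ≡⟨ cong φ (sym (*-identityʳ w)) ⟩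
      φ (w · 𝟙)       ≡⟨ φ-· w 𝟙 ⟩
      φ w · φ 𝟙       ≡⟨ cong (_· φ 𝟙) (φ-preimage φ-bij 𝟙) ⟩
      𝟙 · φ 𝟙         ≡⟨ *-identityˡ _ ⟩
      φ 𝟙             ∎)
      where
      open ≡-Reasoning
      w = preimage φ-bij 𝟙

    φ-𝟘 : φ 𝟘 ≡ 𝟘
    φ-𝟘 = begin
      φ 𝟘             ≡⟨ cong φ (sym (zeroˡ w)) ⟩
      φ (𝟘 · w)       ≡⟨ φ-· 𝟘 w ⟩
      φ 𝟘 · φ w       ≡⟨ cong (φ 𝟘 ·_) (φ-preimage φ-bij 𝟘) ⟩
      φ 𝟘 · 𝟘         ≡⟨ zeroʳ _ ⟩
      𝟘               ∎
      where
      open ≡-Reasoning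
      w = preimage φ-bij 𝟘

    -- φ(xᶜ) and (φ x)ᶜ are both the largest element disjoint from φ x.
    φ-ᶜ : ∀ x → φ (x ᶜ) ≡ φ x ᶜ
    φ-ᶜ x = begin
      φ (x ᶜ)               ≡⟨ sym (disjoint⇒below-complement (φ (x ᶜ)) (φ x) φxᶜ-disjoint) ⟩
      φ (x ᶜ) · φ x ᶜ       ≡⟨ *-comm _ _ ⟩
      φ x ᶜ · φ (x ᶜ)       ≡⟨ cong (_· φ (x ᶜ)) (sym (φ-preimage φ-bij (φ x ᶜ))) ⟩
      φ w · φ (x ᶜ)         ≡⟨ sym (φ-· w (x ᶜ)) ⟩
      φ (w · x ᶜ)           ≡⟨ cong φ (disjoint⇒below-complement w x w-disjoint) ⟩
      φ w                   ≡⟨ φ-preimage φ-bij (φ x ᶜ) ⟩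
      φ x ᶜ                 ∎
      where
      open ≡-Reasoning
      w = preimage φ-bij (φ x ᶜ)
      φxᶜ-disjoint : φ (x ᶜ) · φ x ≡ 𝟘
      φxᶜ-disjoint = trans (sym (φ-· (x ᶜ) x)) (trans (cong φ (complement-· x)) φ-𝟘)
      w-disjoint : w · x ≡ 𝟘
      w-disjoint = proj₁ φ-bij (begin
        φ (w · x)             ≡⟨ φ-· w x ⟩
        φ w · φ x             ≡⟨ cong (_· φ x) (φ-preimage φ-bij (φ x ᶜ)) ⟩
        φ x ᶜ · φ x           ≡⟨ complement-· (φ x) ⟩
        𝟘                     ≡⟨ sym φ-𝟘 ⟩
        φ 𝟘                   ∎)

    sum-via-meets : ∀ x y → x + y ≡ ((x · y ᶜ) ᶜ · (y · x ᶜ) ᶜ) ᶜ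
    sum-via-meets x y = solve (X :+ Y) (((X :· (Y :+ :𝟙)) :+ :𝟙) :· ((Y :· (X :+ :𝟙)) :+ :𝟙) :+ :𝟙)
                              refl R (x ∷ y ∷ [])

    φ-+ : ∀ x y → φ (x + y) ≡ φ x + φ y
    φ-+ x y = begin
      φ (x + y)                                   ≡⟨ cong φ (sum-via-meets x y) ⟩
      φ (((x · y ᶜ) ᶜ · (y · x ᶜ) ᶜ) ᶜ)           ≡⟨ φ-ᶜ _ ⟩
      φ ((x · y ᶜ) ᶜ · (y · x ᶜ) ᶜ) ᶜ             ≡⟨ cong _ᶜ (φ-· _ _) ⟩
      (φ ((x · y ᶜ) ᶜ) · φ ((y · x ᶜ) ᶜ)) ᶜ       ≡⟨ cong _ᶜ (cong₂ _·_ (φ-complement-meet x y) (φ-complement-meet y x)) ⟩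
      ((φ x · φ y ᶜ) ᶜ · (φ y · φ x ᶜ) ᶜ) ᶜ       ≡⟨ sym (sum-via-meets (φ x) (φ y)) ⟩
      φ x + φ y                                   ∎
      where
      open ≡-Reasoning
      φ-complement-meet : ∀ u v → φ ((u · v ᶜ) ᶜ) ≡ (φ u · φ v ᶜ) ᶜ
      φ-complement-meet u v = trans (φ-ᶜ _) (cong _ᶜ (trans (φ-· u _) (cong (φ u ·_) (φ-ᶜ v))))

    automorphism : IsHomomorphism R R φ
    automorphism = record { hom-+ = φ-+ ; hom-· = φ-· ; hom-𝟘 = φ-𝟘 ; hom-𝟙 = φ-𝟙 }

  infixl 6 _∨_
  _∨_ : Carrier → Carrier → Carrier
  x ∨ y = x + y + x · y

  de-morgan : ∀ x y → (x · y) ᶜ ≡ x ᶜ ∨ y ᶜ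
  de-morgan x y = solve (X :· Y :+ :𝟙) ((X :+ :𝟙) :+ (Y :+ :𝟙) :+ (X :+ :𝟙) :· (Y :+ :𝟙))
                        refl R (x ∷ y ∷ [])

  -- A bijection preserving ∨ is an automorphism: its conjugate α = ᶜ ∘ φ ∘ ᶜ
  -- preserves · by De Morgan, and φ coincides with the automorphism α.
  ∨-preserving⇒automorphism : ∀ {φ} → Bij φ → (∀ x y → φ (x ∨ y) ≡ φ x ∨ φ y) →
    IsHomomorphism R R φ
  ∨-preserving⇒automorphism {φ} φ-bij φ-∨ = endomorphism-ext φ≗α α-automorphism
    where
    α : Carrier → Carrier
    α u = φ (u ᶜ) ᶜ

    φ-ᶜ : ∀ u → φ (u ᶜ) ≡ α u ᶜ
    φ-ᶜ u = sym (ᶜ-involutive (φ (u ᶜ)))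

    α-· : ∀ x y → α (x · y) ≡ α x · α y
    α-· x y = begin
      φ ((x · y) ᶜ) ᶜ               ≡⟨ cong (λ u → φ u ᶜ) (de-morgan x y) ⟩
      φ (x ᶜ ∨ y ᶜ) ᶜ               ≡⟨ cong _ᶜ (φ-∨ (x ᶜ) (y ᶜ)) ⟩
      (φ (x ᶜ) ∨ φ (y ᶜ)) ᶜ         ≡⟨ cong _ᶜ (cong₂ _∨_ (φ-ᶜ x) (φ-ᶜ y)) ⟩
      (α x ᶜ ∨ α y ᶜ) ᶜ             ≡⟨ cong _ᶜ (sym (de-morgan (α x) (α y))) ⟩
      (α x · α y) ᶜ ᶜ               ≡⟨ ᶜ-involutive _ ⟩
      α x · α y                     ∎
      where open ≡-Reasoning

    α-bij : Bij α
    α-bij = Composition.bijective _≡_ _≡_ _≡_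
      (Composition.bijective _≡_ _≡_ _≡_ (translation-bijective 𝟙) φ-bij) (translation-bijective 𝟙)

    α-automorphism : IsHomomorphism R R α
    α-automorphism = ·-Preserving.automorphism α-bij α-·
    open IsHomomorphism α-automorphism

    φ≗α : ∀ x → φ x ≡ α x
    φ≗α x = begin
      φ x                 ≡⟨ cong φ (sym (ᶜ-involutive x)) ⟩
      φ (x ᶜ ᶜ)           ≡⟨ φ-ᶜ (x ᶜ) ⟩
      α (x ᶜ) ᶜ           ≡⟨ cong _ᶜ (trans (hom-+ x 𝟙) (cong (α x +_) hom-𝟙)) ⟩
      α x ᶜ ᶜ             ≡⟨ ᶜ-involutive (α x) ⟩
      α x                 ∎
      where open ≡-Reasoning

  automorphism⇒median-preserving : ∀ {φ} → IsHomomorphism R R φ → Preserves R (median R) φ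
  automorphism⇒median-preserving H (x ∷ y ∷ z ∷ []) = natural (expressionOp medianExp) H (x ∷ y ∷ z ∷ [])

  -- A bijection φ preserving the median becomes an automorphism after
  -- translating by φ 𝟘, because x·y = M(x,y,𝟘) and M(u,v,a) + a = (u+a)·(v+a).
  median-preserving⇒translate-automorphism : ∀ {φ} → Bij φ → Preserves R (median R) φ →
    IsHomomorphism R R (λ x → φ x + φ 𝟘) × Bij (λ x → φ x + φ 𝟘)
  median-preserving⇒translate-automorphism {φ} φ-bij φ-M = ·-Preserving.automorphism ψ-bij ψ-· , ψ-bij
    where
    a = φ 𝟘
    ψ-bij : Bij (λ x → φ x + a)
    ψ-bij = Composition.bijective _≡_ _≡_ _≡_ φ-bij (translation-bijective a)
    meet-as-median : ∀ x y → x · y ≡ median R (x ∷ y ∷ 𝟘 ∷ [])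
    meet-as-median x y = solve meetExp (X :· Y :+ Y :· :𝟘 :+ :𝟘 :· X) refl R (x ∷ y ∷ 𝟘 ∷ [])
    translated-median : ∀ u v → median R (u ∷ v ∷ a ∷ []) + a ≡ (u + a) · (v + a)
    translated-median u v = solve (medianExp :+ Z) ((X :+ Z) :· (Y :+ Z)) refl R (u ∷ v ∷ a ∷ [])
    ψ-· : ∀ x y → φ (x · y) + a ≡ (φ x + a) · (φ y + a)
    ψ-· x y = trans (cong (λ t → φ t + a) (meet-as-median x y))
      (trans (cong (_+ a) (φ-M (x ∷ y ∷ 𝟘 ∷ []))) (translated-median (φ x) (φ y)))

module _ {k : ℕ} (c : Vec Bool (suc k) → Bool) (bs : Vec Bool k) where
  private
    f₀ f₁ : Bool
    f₀ = termFun 𝔹 (c ∘ (false ∷_)) bs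
    f₁ = termFun 𝔹 (c ∘ (true ∷_)) bs

  termFun-false : termFun 𝔹 c (false ∷ bs) ≡ f₀
  termFun-false = trans (TermFunctionExpansion.termFun-step 𝔹 c false bs) (xor-identityʳ f₀)

  termFun-true : termFun 𝔹 c (true ∷ bs) ≡ f₀ xor f₁
  termFun-true = TermFunctionExpansion.termFun-step 𝔹 c true bs

zeros : ∀ k → Vec Bool k
zeros k = replicate k false

xor-cancelˡ : ∀ a b → a xor (a xor b) ≡ b
xor-cancelˡ a b = trans (sym (xor-assoc a a b)) (cong (_xor b) (xor-same a))

nonzero-value : ∀ {k} (c : Vec Bool k → Bool) S → c S ≡ true → ∃ λ τ → termFun 𝔹 c τ ≡ true
nonzero-value c [] cS rewrite cS = [] , refl
nonzero-value c (false ∷ S) cS with nonzero-value (c ∘ (false ∷_)) S cS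
... | τ , f₀τ = false ∷ τ , trans (termFun-false c τ) f₀τ
nonzero-value c (true ∷ S) cS with nonzero-value (c ∘ (true ∷_)) S cS
... | τ , f₁τ with termFun 𝔹 (c ∘ (false ∷_)) τ in f₀τ
...   | false = true ∷ τ , trans (termFun-true c τ) (cong₂ _xor_ f₀τ f₁τ)
...   | true = false ∷ τ , trans (termFun-false c τ) f₀τ

-- A polynomial containing a monomial of degree ≥ 1 is not constant on {0,1}.
-- For the first variable: f₁ τ = 1 makes f(0,τ) and f(1,τ) differ, so one of
-- them differs from f(0,…,0).
nonzero-first-difference : ∀ {k} (c : Vec Bool k → Bool) S → c S ≡ true → 1 ≤ card 𝔹 S →
  ∃ λ τ → termFun 𝔹 c τ xor termFun 𝔹 c (zeros k) ≡ true
nonzero-first-difference c (false ∷ S) cS deg with nonzero-first-difference (c ∘ (false ∷_)) S cS deg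
... | τ , Δ = false ∷ τ , trans (cong₂ _xor_ (termFun-false c τ) (termFun-false c _)) Δ
nonzero-first-difference {suc k} c (true ∷ S) cS deg with nonzero-value (c ∘ (true ∷_)) S cS
... | τ , f₁τ with termFun 𝔹 (c ∘ (false ∷_)) τ in f₀τ | termFun 𝔹 (c ∘ (false ∷_)) (zeros k) in f₀0
...   | true | false = false ∷ τ , trans (cong₂ _xor_ (termFun-false c τ) (termFun-false c _)) (cong₂ _xor_ f₀τ f₀0)
...   | false | true = false ∷ τ , trans (cong₂ _xor_ (termFun-false c τ) (termFun-false c _)) (cong₂ _xor_ f₀τ f₀0)
...   | true | true = true ∷ τ ,
  trans (cong₂ _xor_ (trans (termFun-true c τ) (cong₂ _xor_ f₀τ f₁τ)) (termFun-false c _)) (cong (false xor_) f₀0)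
...   | false | false = true ∷ τ ,
  trans (cong₂ _xor_ (trans (termFun-true c τ) (cong₂ _xor_ f₀τ f₁τ)) (termFun-false c _)) (cong (true xor_) f₀0)

-- The mixed difference in x, y at z = 0 of a ternary Boolean function:
-- the coefficient of xy in its algebraic normal form restricted to z = 0.
xy-difference : (Vec Bool 3 → Bool) → Bool
xy-difference F = (F (false ∷ false ∷ false ∷ []) xor F (true ∷ false ∷ false ∷ []))
              xor (F (false ∷ true ∷ false ∷ []) xor F (true ∷ true ∷ false ∷ []))

minor : ∀ {A : Set} {k} → (Vec A k → A) → Vec (Fin 3) k → Vec A 3 → A
minor F σ v = F (map (lookup v) σ)

-- A polynomial containing a monomial of degree ≥ 2 has a ternary minor with a
-- nonzero xy-difference: keep one variable of the monomial as x, send a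
-- separating point of its cofactor to y, and everything else to z.
nonzero-xy-difference : ∀ {k} (c : Vec Bool k → Bool) S → c S ≡ true → 2 ≤ card 𝔹 S →
  ∃ λ σ → xy-difference (minor (termFun 𝔹 c) σ) ≡ true
nonzero-xy-difference c (false ∷ S) cS deg with nonzero-xy-difference (c ∘ (false ∷_)) S cS deg
... | σ , Δ = suc (suc zero) ∷ σ , trans
  (cong₂ _xor_ (cong₂ _xor_ (termFun-false c _) (termFun-false c _))
               (cong₂ _xor_ (termFun-false c _) (termFun-false c _))) Δ
nonzero-xy-difference {suc k} c (true ∷ S) cS (s≤s deg) with nonzero-first-difference (c ∘ (true ∷_)) S cS deg
... | τ , Δ = zero ∷ map y-or-z τ , difference
  where
  open ≡-Reasoning
  f = termFun 𝔹 c
  f₀ = termFun 𝔹 (c ∘ (false ∷_))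
  f₁ = termFun 𝔹 (c ∘ (true ∷_))
  y-or-z : Bool → Fin 3
  y-or-z b = if b then suc zero else suc (suc zero)
  at : Bool → Bool → Vec Bool k
  at a b = map (lookup (a ∷ b ∷ false ∷ [])) (map y-or-z τ)
  at-true : ∀ a → at a true ≡ τ
  at-true a = lemma τ
    where
    lemma : ∀ {n} (τ : Vec Bool n) → map (lookup (a ∷ true ∷ false ∷ [])) (map y-or-z τ) ≡ τ
    lemma [] = refl
    lemma (true ∷ τ) = cong (true ∷_) (lemma τ)
    lemma (false ∷ τ) = cong (false ∷_) (lemma τ)
  at-false : ∀ a → at a false ≡ zeros k
  at-false a = lemma τ
    where
    lemma : ∀ {n} (τ : Vec Bool n) → map (lookup (a ∷ false ∷ false ∷ [])) (map y-or-z τ) ≡ zeros n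
    lemma [] = refl
    lemma (true ∷ τ) = cong (false ∷_) (lemma τ)
    lemma (false ∷ τ) = cong (false ∷_) (lemma τ)
  difference : xy-difference (minor f (zero ∷ map y-or-z τ)) ≡ true
  difference = begin
    (f (false ∷ at false false) xor f (true ∷ at true false)) xor (f (false ∷ at false true) xor f (true ∷ at true true))
      ≡⟨ cong₂ _xor_ (cong₂ _xor_ (cong (λ w → f (false ∷ w)) (at-false false)) (cong (λ w → f (true ∷ w)) (at-false true)))
                     (cong₂ _xor_ (cong (λ w → f (false ∷ w)) (at-true false)) (cong (λ w → f (true ∷ w)) (at-true true))) ⟩
    (f (false ∷ zeros k) xor f (true ∷ zeros k)) xor (f (false ∷ τ) xor f (true ∷ τ))
      ≡⟨ cong₂ _xor_ (cong₂ _xor_ (termFun-false c _) (termFun-true c _)) (cong₂ _xor_ (termFun-false c _) (termFun-true c _)) ⟩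
    (f₀ (zeros k) xor (f₀ (zeros k) xor f₁ (zeros k))) xor (f₀ τ xor (f₀ τ xor f₁ τ))
      ≡⟨ cong₂ _xor_ (xor-cancelˡ (f₀ (zeros k)) (f₁ (zeros k))) (xor-cancelˡ (f₀ τ) (f₁ τ)) ⟩
    f₁ (zeros k) xor f₁ τ
      ≡⟨ trans (xor-comm (f₁ (zeros k)) (f₁ τ)) Δ ⟩
    true ∎

minor-preserved : ∀ {A B : Set} (h : A → B) {k} {F : Vec A k → A} {G : Vec B k → B} → (∀ xs → h (F xs) ≡ G (map h xs)) →
  ∀ σ v → h (minor F σ v) ≡ minor G σ (map h v)
minor-preserved h {F = F} {G} F-pres σ v = trans (F-pres _)
  (cong G (trans (sym (V.map-∘ h (lookup v) σ)) (V.map-cong (λ j → sym (V.lookup-map j h v)) σ)))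

minorOp : ∀ {k} → (Vec Bool k → Bool) → Vec (Fin 3) k → NaturalOperation 3
minorOp c σ = record
  { op = λ R → minor (termFun R c) σ
  ; natural = λ {R} {S} {h} H → minor-preserved h {F = termFun R c} {G = termFun S c} (Homomorphism.hom-termFun H c) σ }

data Term : Set where
  π : Fin 3 → Term
  g⟨_,_,_⟩ : Term → Term → Term → Term

π₀ π₁ π₂ : Term
π₀ = π zero
π₁ = π (suc zero)
π₂ = π (suc (suc zero))

⟪_⟫ : Term → ∀ {A : Set} → (Vec A 3 → A) → Vec A 3 → A
⟪ π j ⟫ g xs = lookup xs j
⟪ g⟨ t₁ , t₂ , t₃ ⟩ ⟫ g xs = g (⟪ t₁ ⟫ g xs ∷ ⟪ t₂ ⟫ g xs ∷ ⟪ t₃ ⟫ g xs ∷ [])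

term-preserved : ∀ {A B : Set} (h : A → B) {g : Vec A 3 → A} {g′ : Vec B 3 → B} →
  (∀ ys → h (g ys) ≡ g′ (map h ys)) → ∀ t xs → h (⟪ t ⟫ g xs) ≡ ⟪ t ⟫ g′ (map h xs)
term-preserved h g-pres (π j) xs = sym (V.lookup-map j h xs)
term-preserved h {g′ = g′} g-pres g⟨ t₁ , t₂ , t₃ ⟩ xs = trans (g-pres _)
  (cong g′ (cong₂ _∷_ (term-preserved h g-pres t₁ xs)
           (cong₂ _∷_ (term-preserved h g-pres t₂ xs) (cong (_∷ []) (term-preserved h g-pres t₃ xs)))))

termOp : Term → Table 3 → NaturalOperation 3
termOp t p = record { op = λ R → ⟪ t ⟫ (eval R p) ; natural = λ {R} {S} {h} H → term-preserved h (eval-natural H p) t }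

data Target : Set where
  meet join majority : Target

targetExp : Target → Exp 3
targetExp meet = meetExp
targetExp join = joinExp
targetExp majority = medianExp

Good : Table 3 → Bool
Good g = xy-difference (eval 𝔹 g)

Certifies : Table 3 → Term × Target → Set
Certifies g (t , T) = ⟪ t ⟫ (eval (TT 3) g) (vars 3) ≡ ⟦ targetExp T ⟧ (TT 3) (vars 3)

-- For each good table g = (((g₀₀₀ , g₀₀₁) , (g₀₁₀ , g₀₁₁)) , ((g₁₀₀ , g₁₀₁) , (g₁₁₀ , g₁₁₁)))
-- a term over g computing x·y, x ∨ y or the median; the remaining tables are irrelevant.
certificate : Table 3 → Term × Target
certificate (((false , false) , (false , false)) , ((false , false) , (true , false))) = g⟨ π₀ , π₀ , g⟨ π₀ , π₀ , π₁ ⟩ ⟩ , meet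
certificate (((false , false) , (false , false)) , ((false , false) , (true , true))) = g⟨ π₀ , π₁ , π₀ ⟩ , meet
certificate (((false , false) , (false , false)) , ((false , true) , (true , false))) = g⟨ π₀ , π₀ , g⟨ π₀ , π₀ , π₁ ⟩ ⟩ , meet
certificate (((false , false) , (false , false)) , ((false , true) , (true , true))) = g⟨ π₀ , π₁ , π₁ ⟩ , meet
certificate (((false , false) , (false , false)) , ((true , false) , (false , false))) = g⟨ π₀ , g⟨ π₀ , π₀ , π₀ ⟩ , g⟨ π₀ , π₁ , π₁ ⟩ ⟩ , meet
certificate (((false , false) , (false , false)) , ((true , false) , (false , true))) = g⟨ π₀ , π₀ , π₁ ⟩ , meet
certificate (((false , false) , (false , false)) , ((true , true) , (false , false))) = g⟨ π₀ , g⟨ π₀ , π₁ , π₀ ⟩ , π₀ ⟩ , meet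
certificate (((false , false) , (false , false)) , ((true , true) , (false , true))) = g⟨ π₀ , π₀ , π₁ ⟩ , meet
certificate (((false , false) , (false , true)) , ((false , false) , (true , false))) = g⟨ π₀ , π₀ , g⟨ π₀ , π₀ , π₁ ⟩ ⟩ , meet
certificate (((false , false) , (false , true)) , ((false , false) , (true , true))) = g⟨ π₀ , π₁ , π₀ ⟩ , meet
certificate (((false , false) , (false , true)) , ((false , true) , (true , false))) = g⟨ π₀ , π₀ , g⟨ π₀ , π₀ , π₁ ⟩ ⟩ , meet
certificate (((false , false) , (false , true)) , ((false , true) , (true , true))) = g⟨ π₀ , π₁ , π₂ ⟩ , majority
certificate (((false , false) , (false , true)) , ((true , false) , (false , false))) = g⟨ π₀ , g⟨ π₀ , π₀ , π₀ ⟩ , g⟨ π₀ , π₁ , π₁ ⟩ ⟩ , meet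
certificate (((false , false) , (false , true)) , ((true , false) , (false , true))) = g⟨ π₀ , π₀ , π₁ ⟩ , meet
certificate (((false , false) , (false , true)) , ((true , true) , (false , false))) = g⟨ π₀ , g⟨ π₀ , π₁ , π₀ ⟩ , π₀ ⟩ , meet
certificate (((false , false) , (false , true)) , ((true , true) , (false , true))) = g⟨ π₀ , π₀ , π₁ ⟩ , meet
certificate (((false , false) , (true , false)) , ((false , false) , (false , false))) = g⟨ g⟨ π₀ , π₀ , π₀ ⟩ , π₀ , g⟨ π₁ , π₀ , π₁ ⟩ ⟩ , meet
certificate (((false , false) , (true , false)) , ((false , false) , (false , true))) = g⟨ π₀ , π₀ , π₁ ⟩ , meet
certificate (((false , false) , (true , false)) , ((false , true) , (false , false))) = g⟨ π₀ , g⟨ π₀ , π₀ , π₀ ⟩ , π₁ ⟩ , meet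
certificate (((false , false) , (true , false)) , ((false , true) , (false , true))) = g⟨ π₀ , π₀ , π₁ ⟩ , meet
certificate (((false , false) , (true , false)) , ((true , false) , (true , false))) = g⟨ π₀ , π₀ , g⟨ π₀ , π₀ , π₁ ⟩ ⟩ , meet
certificate (((false , false) , (true , false)) , ((true , false) , (true , true))) = g⟨ π₀ , π₁ , g⟨ π₀ , π₁ , π₂ ⟩ ⟩ , majority
certificate (((false , false) , (true , false)) , ((true , true) , (true , false))) = g⟨ π₀ , π₀ , g⟨ π₀ , π₀ , π₁ ⟩ ⟩ , meet
certificate (((false , false) , (true , false)) , ((true , true) , (true , true))) = g⟨ π₀ , π₁ , π₀ ⟩ , join
certificate (((false , false) , (true , true)) , ((false , false) , (false , false))) = g⟨ g⟨ π₀ , π₁ , π₀ ⟩ , π₁ , π₀ ⟩ , meet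
certificate (((false , false) , (true , true)) , ((false , false) , (false , true))) = g⟨ π₀ , π₀ , π₁ ⟩ , meet
certificate (((false , false) , (true , true)) , ((false , true) , (false , false))) = g⟨ π₀ , g⟨ π₀ , π₀ , π₀ ⟩ , π₁ ⟩ , meet
certificate (((false , false) , (true , true)) , ((false , true) , (false , true))) = g⟨ π₀ , π₀ , π₁ ⟩ , meet
certificate (((false , false) , (true , true)) , ((true , false) , (true , false))) = g⟨ π₀ , π₀ , g⟨ π₀ , π₀ , π₁ ⟩ ⟩ , meet
certificate (((false , false) , (true , true)) , ((true , false) , (true , true))) = g⟨ π₀ , π₁ , π₁ ⟩ , join
certificate (((false , false) , (true , true)) , ((true , true) , (true , false))) = g⟨ π₀ , π₀ , g⟨ π₀ , π₀ , π₁ ⟩ ⟩ , meet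
certificate (((false , false) , (true , true)) , ((true , true) , (true , true))) = g⟨ π₀ , π₁ , π₀ ⟩ , join
certificate (((false , true) , (false , false)) , ((false , false) , (true , false))) = g⟨ π₀ , π₁ , g⟨ π₀ , π₀ , π₀ ⟩ ⟩ , meet
certificate (((false , true) , (false , false)) , ((false , false) , (true , true))) = g⟨ π₀ , π₁ , π₀ ⟩ , meet
certificate (((false , true) , (false , false)) , ((false , true) , (true , false))) = g⟨ π₀ , π₀ , g⟨ π₀ , π₁ , π₀ ⟩ ⟩ , meet
certificate (((false , true) , (false , false)) , ((false , true) , (true , true))) = g⟨ π₀ , π₁ , π₁ ⟩ , meet
certificate (((false , true) , (false , false)) , ((true , false) , (false , false))) = g⟨ π₀ , g⟨ π₀ , π₀ , π₀ ⟩ , g⟨ π₀ , π₁ , π₁ ⟩ ⟩ , meet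
certificate (((false , true) , (false , false)) , ((true , false) , (false , true))) = g⟨ π₀ , π₁ , π₀ ⟩ , meet
certificate (((false , true) , (false , false)) , ((true , true) , (false , false))) = g⟨ π₀ , g⟨ π₀ , π₁ , π₀ ⟩ , π₀ ⟩ , meet
certificate (((false , true) , (false , false)) , ((true , true) , (false , true))) = g⟨ π₀ , g⟨ π₀ , π₁ , π₂ ⟩ , π₂ ⟩ , majority
certificate (((false , true) , (false , true)) , ((false , false) , (true , false))) = g⟨ π₀ , π₀ , g⟨ π₁ , π₀ , π₀ ⟩ ⟩ , meet
certificate (((false , true) , (false , true)) , ((false , false) , (true , true))) = g⟨ π₀ , π₁ , π₀ ⟩ , meet
certificate (((false , true) , (false , true)) , ((false , true) , (true , false))) = g⟨ π₀ , π₀ , g⟨ π₀ , π₁ , π₀ ⟩ ⟩ , meet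
certificate (((false , true) , (false , true)) , ((false , true) , (true , true))) = g⟨ π₀ , π₀ , π₁ ⟩ , join
certificate (((false , true) , (false , true)) , ((true , false) , (false , false))) = g⟨ π₀ , g⟨ π₀ , π₀ , π₀ ⟩ , g⟨ π₁ , π₁ , π₀ ⟩ ⟩ , meet
certificate (((false , true) , (false , true)) , ((true , false) , (false , true))) = g⟨ π₀ , π₁ , π₀ ⟩ , meet
certificate (((false , true) , (false , true)) , ((true , true) , (false , false))) = g⟨ π₀ , g⟨ π₀ , π₁ , π₀ ⟩ , π₀ ⟩ , meet
certificate (((false , true) , (false , true)) , ((true , true) , (false , true))) = g⟨ π₀ , π₁ , π₁ ⟩ , join
certificate (((false , true) , (true , false)) , ((false , false) , (false , false))) = g⟨ g⟨ π₀ , π₀ , π₀ ⟩ , π₀ , g⟨ π₁ , π₀ , π₁ ⟩ ⟩ , meet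
certificate (((false , true) , (true , false)) , ((false , false) , (false , true))) = g⟨ π₀ , π₁ , π₁ ⟩ , meet
certificate (((false , true) , (true , false)) , ((false , true) , (false , false))) = g⟨ π₀ , g⟨ π₀ , π₀ , π₁ ⟩ , π₁ ⟩ , meet
certificate (((false , true) , (true , false)) , ((false , true) , (false , true))) = g⟨ π₀ , π₁ , π₁ ⟩ , meet
certificate (((false , true) , (true , false)) , ((true , false) , (true , false))) = g⟨ π₀ , π₀ , g⟨ π₀ , π₁ , π₁ ⟩ ⟩ , meet
certificate (((false , true) , (true , false)) , ((true , false) , (true , true))) = g⟨ π₀ , π₀ , π₁ ⟩ , join
certificate (((false , true) , (true , false)) , ((true , true) , (true , false))) = g⟨ π₀ , π₀ , g⟨ π₀ , π₁ , π₁ ⟩ ⟩ , meet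
certificate (((false , true) , (true , false)) , ((true , true) , (true , true))) = g⟨ π₀ , π₀ , π₁ ⟩ , join
certificate (((false , true) , (true , true)) , ((false , false) , (false , false))) = g⟨ g⟨ π₀ , π₀ , π₁ ⟩ , π₁ , π₁ ⟩ , meet
certificate (((false , true) , (true , true)) , ((false , false) , (false , true))) = g⟨ g⟨ π₀ , π₁ , π₂ ⟩ , π₁ , π₂ ⟩ , majority
certificate (((false , true) , (true , true)) , ((false , true) , (false , false))) = g⟨ π₀ , g⟨ π₁ , π₀ , π₀ ⟩ , π₀ ⟩ , meet
certificate (((false , true) , (true , true)) , ((false , true) , (false , true))) = g⟨ π₀ , π₁ , π₀ ⟩ , join
certificate (((false , true) , (true , true)) , ((true , false) , (true , false))) = g⟨ π₀ , π₀ , g⟨ π₁ , π₀ , π₁ ⟩ ⟩ , meet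
certificate (((false , true) , (true , true)) , ((true , false) , (true , true))) = g⟨ π₀ , π₀ , π₁ ⟩ , join
certificate (((false , true) , (true , true)) , ((true , true) , (true , false))) = g⟨ π₀ , π₁ , g⟨ π₀ , π₀ , π₀ ⟩ ⟩ , join
certificate (((false , true) , (true , true)) , ((true , true) , (true , true))) = g⟨ π₀ , π₀ , π₁ ⟩ , join
certificate (((true , false) , (false , false)) , ((false , false) , (false , false))) = g⟨ g⟨ π₀ , π₀ , π₀ ⟩ , g⟨ π₀ , π₀ , π₀ ⟩ , g⟨ π₁ , π₁ , π₁ ⟩ ⟩ , meet
certificate (((true , false) , (false , false)) , ((false , false) , (false , true))) = g⟨ π₀ , π₁ , g⟨ π₀ , π₀ , π₀ ⟩ ⟩ , meet
certificate (((true , false) , (false , false)) , ((false , true) , (false , false))) = g⟨ π₀ , g⟨ π₀ , π₀ , π₀ ⟩ , π₁ ⟩ , meet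
certificate (((true , false) , (false , false)) , ((false , true) , (false , true))) = g⟨ π₀ , π₀ , g⟨ π₁ , π₀ , π₁ ⟩ ⟩ , meet
certificate (((true , false) , (false , false)) , ((true , false) , (true , false))) = g⟨ π₀ , π₁ , g⟨ π₀ , π₀ , π₁ ⟩ ⟩ , meet
certificate (((true , false) , (false , false)) , ((true , false) , (true , true))) = g⟨ π₀ , π₁ , g⟨ π₀ , π₀ , π₀ ⟩ ⟩ , meet
certificate (((true , false) , (false , false)) , ((true , true) , (true , false))) = g⟨ π₀ , g⟨ π₀ , π₀ , π₁ ⟩ , g⟨ π₀ , π₀ , π₂ ⟩ ⟩ , majority
certificate (((true , false) , (false , false)) , ((true , true) , (true , true))) = g⟨ π₀ , π₀ , g⟨ π₀ , π₀ , π₁ ⟩ ⟩ , join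
certificate (((true , false) , (false , true)) , ((false , false) , (false , false))) = g⟨ g⟨ π₀ , π₀ , π₀ ⟩ , π₀ , π₁ ⟩ , meet
certificate (((true , false) , (false , true)) , ((false , false) , (false , true))) = g⟨ π₀ , π₀ , g⟨ π₀ , π₁ , π₁ ⟩ ⟩ , meet
certificate (((true , false) , (false , true)) , ((false , true) , (false , false))) = g⟨ π₀ , g⟨ π₀ , π₀ , π₁ ⟩ , π₁ ⟩ , meet
certificate (((true , false) , (false , true)) , ((false , true) , (false , true))) = g⟨ π₀ , π₀ , g⟨ π₀ , π₁ , π₁ ⟩ ⟩ , meet
certificate (((true , false) , (false , true)) , ((true , false) , (true , false))) = g⟨ π₀ , π₀ , g⟨ π₀ , π₁ , π₁ ⟩ ⟩ , meet
certificate (((true , false) , (false , true)) , ((true , false) , (true , true))) = g⟨ π₀ , π₁ , g⟨ π₀ , π₀ , π₁ ⟩ ⟩ , meet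
certificate (((true , false) , (false , true)) , ((true , true) , (true , false))) = g⟨ π₀ , π₀ , g⟨ π₀ , π₁ , π₁ ⟩ ⟩ , meet
certificate (((true , false) , (false , true)) , ((true , true) , (true , true))) = g⟨ π₀ , π₀ , g⟨ π₀ , π₀ , π₁ ⟩ ⟩ , join
certificate (((true , false) , (true , false)) , ((false , false) , (true , false))) = g⟨ π₀ , π₁ , g⟨ π₀ , π₀ , π₀ ⟩ ⟩ , meet
certificate (((true , false) , (true , false)) , ((false , false) , (true , true))) = g⟨ π₀ , π₁ , g⟨ π₀ , π₀ , π₀ ⟩ ⟩ , meet
certificate (((true , false) , (true , false)) , ((false , true) , (true , false))) = g⟨ π₀ , π₀ , g⟨ π₀ , π₁ , π₀ ⟩ ⟩ , meet
certificate (((true , false) , (true , false)) , ((false , true) , (true , true))) = g⟨ π₀ , π₁ , g⟨ π₁ , π₁ , π₀ ⟩ ⟩ , meet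
certificate (((true , false) , (true , false)) , ((true , false) , (false , false))) = g⟨ π₀ , g⟨ π₀ , π₁ , π₁ ⟩ , g⟨ π₀ , π₀ , π₀ ⟩ ⟩ , meet
certificate (((true , false) , (true , false)) , ((true , false) , (false , true))) = g⟨ π₀ , π₀ , g⟨ π₀ , π₁ , π₀ ⟩ ⟩ , meet
certificate (((true , false) , (true , false)) , ((true , true) , (false , false))) = g⟨ π₀ , g⟨ π₀ , π₁ , π₀ ⟩ , g⟨ π₀ , π₀ , π₀ ⟩ ⟩ , meet
certificate (((true , false) , (true , false)) , ((true , true) , (false , true))) = g⟨ π₀ , π₀ , g⟨ π₁ , π₀ , π₀ ⟩ ⟩ , meet
certificate (((true , false) , (true , true)) , ((false , false) , (true , false))) = g⟨ g⟨ π₀ , π₀ , π₀ ⟩ , π₁ , g⟨ π₀ , π₀ , π₂ ⟩ ⟩ , majority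
certificate (((true , false) , (true , true)) , ((false , false) , (true , true))) = g⟨ π₀ , π₀ , g⟨ π₀ , π₀ , π₁ ⟩ ⟩ , join
certificate (((true , false) , (true , true)) , ((false , true) , (true , false))) = g⟨ π₀ , π₀ , g⟨ π₀ , π₁ , π₀ ⟩ ⟩ , meet
certificate (((true , false) , (true , true)) , ((false , true) , (true , true))) = g⟨ π₀ , π₀ , g⟨ π₀ , π₀ , π₁ ⟩ ⟩ , join
certificate (((true , false) , (true , true)) , ((true , false) , (false , false))) = g⟨ g⟨ π₀ , π₀ , π₀ ⟩ , π₁ , g⟨ π₀ , π₁ , π₁ ⟩ ⟩ , meet
certificate (((true , false) , (true , true)) , ((true , false) , (false , true))) = g⟨ π₀ , π₀ , g⟨ π₀ , π₁ , π₀ ⟩ ⟩ , meet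
certificate (((true , false) , (true , true)) , ((true , true) , (false , false))) = g⟨ g⟨ π₀ , π₀ , π₀ ⟩ , g⟨ π₀ , π₀ , π₀ ⟩ , g⟨ π₀ , π₁ , π₀ ⟩ ⟩ , meet
certificate (((true , false) , (true , true)) , ((true , true) , (false , true))) = g⟨ π₀ , π₁ , g⟨ π₀ , π₀ , π₀ ⟩ ⟩ , join
certificate (((true , true) , (false , false)) , ((false , false) , (false , false))) = g⟨ g⟨ π₀ , π₀ , π₀ ⟩ , g⟨ π₁ , π₁ , π₀ ⟩ , π₀ ⟩ , meet
certificate (((true , true) , (false , false)) , ((false , false) , (false , true))) = g⟨ π₀ , g⟨ π₀ , π₀ , π₀ ⟩ , π₁ ⟩ , meet
certificate (((true , true) , (false , false)) , ((false , true) , (false , false))) = g⟨ π₀ , g⟨ π₀ , π₀ , π₀ ⟩ , π₁ ⟩ , meet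
certificate (((true , true) , (false , false)) , ((false , true) , (false , true))) = g⟨ π₀ , g⟨ π₀ , π₀ , π₀ ⟩ , π₁ ⟩ , meet
certificate (((true , true) , (false , false)) , ((true , false) , (true , false))) = g⟨ π₀ , g⟨ π₀ , π₀ , π₀ ⟩ , g⟨ π₀ , π₀ , π₁ ⟩ ⟩ , meet
certificate (((true , true) , (false , false)) , ((true , false) , (true , true))) = g⟨ π₀ , g⟨ π₁ , π₀ , π₀ ⟩ , π₀ ⟩ , meet
certificate (((true , true) , (false , false)) , ((true , true) , (true , false))) = g⟨ π₀ , g⟨ π₀ , π₀ , π₁ ⟩ , π₀ ⟩ , meet
certificate (((true , true) , (false , false)) , ((true , true) , (true , true))) = g⟨ π₀ , g⟨ π₀ , π₁ , π₀ ⟩ , π₀ ⟩ , join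
certificate (((true , true) , (false , true)) , ((false , false) , (false , false))) = g⟨ g⟨ π₀ , π₀ , π₀ ⟩ , π₀ , π₁ ⟩ , meet
certificate (((true , true) , (false , true)) , ((false , false) , (false , true))) = g⟨ π₀ , g⟨ π₀ , π₀ , π₁ ⟩ , π₀ ⟩ , meet
certificate (((true , true) , (false , true)) , ((false , true) , (false , false))) = g⟨ g⟨ π₀ , π₀ , π₀ ⟩ , g⟨ π₀ , π₁ , π₀ ⟩ , π₂ ⟩ , majority
certificate (((true , true) , (false , true)) , ((false , true) , (false , true))) = g⟨ π₀ , g⟨ π₀ , π₁ , π₀ ⟩ , π₀ ⟩ , join
certificate (((true , true) , (false , true)) , ((true , false) , (true , false))) = g⟨ g⟨ π₀ , π₀ , π₀ ⟩ , g⟨ π₀ , π₀ , π₁ ⟩ , g⟨ π₀ , π₀ , π₀ ⟩ ⟩ , meet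
certificate (((true , true) , (false , true)) , ((true , false) , (true , true))) = g⟨ π₀ , g⟨ π₀ , π₀ , π₀ ⟩ , π₁ ⟩ , join
certificate (((true , true) , (false , true)) , ((true , true) , (true , false))) = g⟨ π₀ , g⟨ π₀ , π₀ , π₁ ⟩ , π₀ ⟩ , meet
certificate (((true , true) , (false , true)) , ((true , true) , (true , true))) = g⟨ π₀ , g⟨ π₀ , π₀ , π₀ ⟩ , π₁ ⟩ , join
certificate (((true , true) , (true , false)) , ((false , false) , (true , false))) = g⟨ g⟨ π₀ , π₀ , π₀ ⟩ , π₀ , g⟨ π₀ , π₀ , π₁ ⟩ ⟩ , meet
certificate (((true , true) , (true , false)) , ((false , false) , (true , true))) = g⟨ π₀ , g⟨ π₀ , π₁ , π₀ ⟩ , g⟨ π₀ , π₀ , π₀ ⟩ ⟩ , meet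
certificate (((true , true) , (true , false)) , ((false , true) , (true , false))) = g⟨ g⟨ π₀ , π₀ , π₀ ⟩ , g⟨ π₀ , π₀ , π₁ ⟩ , g⟨ π₀ , π₀ , π₁ ⟩ ⟩ , meet
certificate (((true , true) , (true , false)) , ((false , true) , (true , true))) = g⟨ π₀ , g⟨ π₀ , π₀ , π₀ ⟩ , g⟨ π₀ , π₁ , π₁ ⟩ ⟩ , join
certificate (((true , true) , (true , false)) , ((true , false) , (false , false))) = g⟨ π₀ , g⟨ π₀ , π₀ , π₀ ⟩ , g⟨ π₀ , π₁ , π₂ ⟩ ⟩ , majority
certificate (((true , true) , (true , false)) , ((true , false) , (false , true))) = g⟨ π₀ , g⟨ π₀ , π₀ , π₀ ⟩ , g⟨ π₀ , π₀ , π₁ ⟩ ⟩ , meet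
certificate (((true , true) , (true , false)) , ((true , true) , (false , false))) = g⟨ π₀ , g⟨ π₀ , π₁ , π₀ ⟩ , g⟨ π₀ , π₀ , π₀ ⟩ ⟩ , meet
certificate (((true , true) , (true , false)) , ((true , true) , (false , true))) = g⟨ π₀ , g⟨ π₀ , π₀ , π₀ ⟩ , g⟨ π₀ , π₀ , π₁ ⟩ ⟩ , meet
certificate (((true , true) , (true , true)) , ((false , false) , (true , false))) = g⟨ g⟨ π₀ , π₀ , π₁ ⟩ , π₀ , π₀ ⟩ , meet
certificate (((true , true) , (true , true)) , ((false , false) , (true , true))) = g⟨ g⟨ π₀ , π₁ , π₀ ⟩ , π₁ , π₀ ⟩ , join
certificate (((true , true) , (true , true)) , ((false , true) , (true , false))) = g⟨ g⟨ π₀ , π₀ , π₁ ⟩ , π₀ , π₀ ⟩ , meet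
certificate (((true , true) , (true , true)) , ((false , true) , (true , true))) = g⟨ g⟨ π₀ , π₀ , π₀ ⟩ , π₀ , π₁ ⟩ , join
certificate (((true , true) , (true , true)) , ((true , false) , (false , false))) = g⟨ g⟨ π₀ , π₁ , π₁ ⟩ , π₀ , g⟨ π₀ , π₀ , π₀ ⟩ ⟩ , meet
certificate (((true , true) , (true , true)) , ((true , false) , (false , true))) = g⟨ g⟨ π₀ , π₀ , π₀ ⟩ , π₀ , g⟨ π₀ , π₀ , π₁ ⟩ ⟩ , meet
certificate (((true , true) , (true , true)) , ((true , true) , (false , false))) = g⟨ g⟨ π₀ , π₁ , π₀ ⟩ , g⟨ π₀ , π₁ , π₀ ⟩ , π₀ ⟩ , meet
certificate (((true , true) , (true , true)) , ((true , true) , (false , true))) = g⟨ g⟨ π₀ , π₀ , π₀ ⟩ , g⟨ π₀ , π₀ , π₁ ⟩ , π₁ ⟩ , join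
certificate _ = π₀ , meet

all-tables : ∀ {n} → (Table n → Bool) → Bool
all-tables {zero} P = P false ∧ P true
all-tables {suc n} P = all-tables {n} (λ p₀ → all-tables {n} (λ p₁ → P (p₀ , p₁)))

∧-true : ∀ {a b} → a ∧ b ≡ true → a ≡ true × b ≡ true
∧-true {true} {true} _ = refl , refl

all-tables-sound : ∀ {n} (P : Table n → Bool) → all-tables {n} P ≡ true → ∀ p → P p ≡ true
all-tables-sound {zero} P all false = proj₁ (∧-true all)
all-tables-sound {zero} P all true = proj₂ (∧-true all)
all-tables-sound {suc n} P all (p₀ , p₁) =
  all-tables-sound {n} (λ p₁ → P (p₀ , p₁)) (all-tables-sound {n} _ all p₀) p₁

_≟ₜ_ : ∀ {n} → DecidableEquality (Table n)
_≟ₜ_ {zero} = Bool._≟_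
_≟ₜ_ {suc n} = Product.≡-dec (_≟ₜ_ {n}) (_≟ₜ_ {n})

yes-witness : ∀ {A : Set} (d : Dec A) → isYes d ≡ true → A
yes-witness (yes a) _ = a

certifies? : ∀ g → Dec (Certifies g (certificate g))
certifies? g = _≟ₜ_ {3} _ _

certified : Table 3 → Bool
certified g = if Good g then isYes (certifies? g) else true

-- Checked by evaluation on all 256 ternary tables.
certificate-correct : ∀ g → Good g ≡ true → Certifies g (certificate g)
certificate-correct g good = yes-witness (certifies? g)
  (subst (λ b → (if b then isYes (certifies? g) else true) ≡ true) good (all-tables-sound {3} certified refl g))

SelfDual : ∀ {k} → (Vec Bool k → Bool) → Set
SelfDual c = ∀ bs → termFun 𝔹 c (map not bs) ≡ not (termFun 𝔹 c bs)

all-or-counterexample : ∀ {k} {P Q : Vec Bool k → Set} → (∀ bs → P bs ⊎ Q bs) → (∀ bs → P bs) ⊎ ∃ Q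
all-or-counterexample {zero} P⊎Q with P⊎Q []
... | inj₁ p = inj₁ λ { [] → p }
... | inj₂ q = inj₂ ([] , q)
all-or-counterexample {suc k} P⊎Q
  with all-or-counterexample (P⊎Q ∘ (false ∷_)) | all-or-counterexample (P⊎Q ∘ (true ∷_))
... | inj₁ p₀ | inj₁ p₁ = inj₁ λ { (false ∷ bs) → p₀ bs ; (true ∷ bs) → p₁ bs }
... | inj₂ (bs , q) | _ = inj₂ (false ∷ bs , q)
... | inj₁ _ | inj₂ (bs , q) = inj₂ (true ∷ bs , q)

self-dual-or-not : ∀ {k} (c : Vec Bool k → Bool) →
  SelfDual c ⊎ ∃ λ bs → termFun 𝔹 c (map not bs) ≡ termFun 𝔹 c bs
self-dual-or-not c = all-or-counterexample λ bs → dichotomy (termFun 𝔹 c (map not bs)) (termFun 𝔹 c bs)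
  where
  dichotomy : ∀ a b → a ≡ not b ⊎ a ≡ b
  dichotomy false true = inj₁ refl
  dichotomy true false = inj₁ refl
  dichotomy false false = inj₂ refl
  dichotomy true true = inj₂ refl

module _ {k : ℕ} (c : Vec Bool k → Bool) where

  translatedOp shiftedOp : NaturalOperation (suc k)
  translatedOp = record
    { op = λ { R (a ∷ xs) → termFun R c (map (λ x → BooleanRing._+_ R x a) xs) }
    ; natural = λ { {R} {S} {h} H (a ∷ xs) → trans (Homomorphism.hom-termFun H c _)
        (cong (termFun S c) (trans (sym (V.map-∘ h _ xs))
          (trans (V.map-cong (λ x → IsHomomorphism.hom-+ H x a) xs) (V.map-∘ _ h xs)))) } }
  shiftedOp = record
    { op = λ { R (a ∷ xs) → BooleanRing._+_ R (termFun R c xs) a }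
    ; natural = λ { {R} {S} {h} H (a ∷ xs) → trans (IsHomomorphism.hom-+ H _ a)
        (cong (λ u → BooleanRing._+_ S u (h a)) (Homomorphism.hom-termFun H c xs)) } }

  self-dual⇒translation-covariant : SelfDual c → ∀ R a xs →
    termFun R c (map (λ x → BooleanRing._+_ R x a) xs) ≡ BooleanRing._+_ R (termFun R c xs) a
  self-dual⇒translation-covariant self-dual R a xs =
    agree-on-𝔹⇒equal translatedOp shiftedOp on-𝔹 R (a ∷ xs)
    where
    on-𝔹 : ∀ bs → op translatedOp 𝔹 bs ≡ op shiftedOp 𝔹 bs
    on-𝔹 (false ∷ bs) = trans (cong (termFun 𝔹 c) (trans (V.map-cong xor-identityʳ bs) (V.map-id bs)))
                              (sym (xor-identityʳ _))
    on-𝔹 (true ∷ bs) = begin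
      termFun 𝔹 c (map (_xor true) bs)   ≡⟨ cong (termFun 𝔹 c) (V.map-cong xor-true bs) ⟩
      termFun 𝔹 c (map not bs)           ≡⟨ self-dual bs ⟩
      not (termFun 𝔹 c bs)               ≡⟨ sym (xor-true _) ⟩
      termFun 𝔹 c bs xor true            ∎
      where
      open ≡-Reasoning
      xor-true : ∀ b → b xor true ≡ not b
      xor-true b = trans (xor-comm b true) (true-xor b)

  -- If f(¬b) = f(b) at a Boolean point b, then f is invariant under all
  -- translations of b: by Shannon expansion in the translation parameter.
  non-self-dual⇒translation-invariant : ∀ bs → termFun 𝔹 c (map not bs) ≡ termFun 𝔹 c bs →
    ∀ R a → termFun R c (map (λ x → BooleanRing._+_ R x a) (map (λ b → eval R b []) bs)) ≡ termFun R c (map (λ b → eval R b []) bs)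
  non-self-dual⇒translation-invariant bs f¬b≡fb R a = begin
    op translatedOp R (a ∷ E)                               ≡⟨ shannon translatedOp R a E ⟩
    select a (op translatedOp R (𝟙 ∷ E)) (op translatedOp R (𝟘 ∷ E))
                                                           ≡⟨ cong₂ (select a) at-𝟙 at-𝟘 ⟩
    select a (termFun R c E) (termFun R c E)                ≡⟨ select-same a _ ⟩
    termFun R c E                                          ∎
    where
    open ≡-Reasoning
    open BooleanRingProperties R
    embed : Bool → Carrier
    embed b = eval R b []
    open Homomorphism (eval-hom R [])
    E = map embed bs
    at-𝟙 : termFun R c (map (_+ 𝟙) E) ≡ termFun R c E
    at-𝟙 = begin
      termFun R c (map (_+ 𝟙) E)          ≡⟨ cong (termFun R c) (trans (sym (V.map-∘ _ embed bs))
                                               (trans (V.map-cong embed-not bs) (V.map-∘ embed not bs))) ⟩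
      termFun R c (map embed (map not bs)) ≡⟨ sym (hom-termFun c (map not bs)) ⟩
      embed (termFun 𝔹 c (map not bs))     ≡⟨ cong embed f¬b≡fb ⟩
      embed (termFun 𝔹 c bs)               ≡⟨ hom-termFun c bs ⟩
      termFun R c E                       ∎
      where
      embed-not : ∀ b → embed b + 𝟙 ≡ embed (not b)
      embed-not true = +-self 𝟙
      embed-not false = +-identityˡ 𝟙
    at-𝟘 : termFun R c (map (_+ 𝟘) E) ≡ termFun R c E
    at-𝟘 = cong (termFun R c) (trans (V.map-cong +-identityʳ E) (V.map-id E))

card-independent : ∀ R S {k} (T : Vec Bool k) → card R T ≡ card S T
card-independent R S [] = refl
card-independent R S (false ∷ T) = card-independent R S T
card-independent R S (true ∷ T) = cong suc (card-independent R S T)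

xy-difference-cong : ∀ {F G : Vec Bool 3 → Bool} → (∀ v → F v ≡ G v) → xy-difference F ≡ xy-difference G
xy-difference-cong F≗G = cong₂ _xor_ (cong₂ _xor_ (F≗G _) (F≗G _)) (cong₂ _xor_ (F≗G _) (F≗G _))

module MainArgument (R : BooleanRing) where
  open BooleanRingProperties R
  open Recognition R

  target-preserving⇒median-preserving : ∀ T {φ} → Bij φ →
    (∀ xs → φ (⟦ targetExp T ⟧ R xs) ≡ ⟦ targetExp T ⟧ R (map φ xs)) → Preserves R (median R) φ
  target-preserving⇒median-preserving meet φ-bij φ-T =
    automorphism⇒median-preserving (·-Preserving.automorphism φ-bij λ x y → φ-T (x ∷ y ∷ x ∷ []))
  target-preserving⇒median-preserving join φ-bij φ-T =
    automorphism⇒median-preserving (∨-preserving⇒automorphism φ-bij λ x y → φ-T (x ∷ y ∷ x ∷ []))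
  target-preserving⇒median-preserving majority φ-bij φ-T (x ∷ y ∷ z ∷ []) = φ-T (x ∷ y ∷ z ∷ [])

  -- Every bijection preserving a non-linear term function preserves the median:
  -- a ternary minor of f has a good table g, and a term over g yields ·, ∨ or M.
  nonlinear⇒median-preserving : ∀ {k} (c : Vec Bool k → Bool) → NonLinear R c →
    ∀ {φ} → Bij φ → Preserves R (termFun R c) φ → Preserves R (median R) φ
  nonlinear⇒median-preserving c (S , cS , deg) {φ} φ-bij φ-f
    with nonzero-xy-difference c S cS (subst (2 ≤_) (card-independent R 𝔹 S) deg)
  ... | σ , Δ = target-preserving⇒median-preserving T φ-bij φ-T
    where
    g = table (minorOp c σ)
    good : Good g ≡ true
    good = trans (xy-difference-cong λ v → sym (represented (minorOp c σ) 𝔹 v)) Δ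
    t = proj₁ (certificate g)
    T = proj₂ (certificate g)
    φ-g : ∀ ys → φ (eval R g ys) ≡ eval R g (map φ ys)
    φ-g ys = trans (cong φ (sym (represented (minorOp c σ) R ys)))
      (trans (minor-preserved φ {F = termFun R c} {G = termFun R c} φ-f σ ys) (represented (minorOp c σ) R (map φ ys)))
    t-computes-T : ∀ xs → ⟪ t ⟫ (eval R g) xs ≡ ⟦ targetExp T ⟧ R xs
    t-computes-T = same-table⇒equal (termOp t g) (expressionOp (targetExp T)) (certificate-correct g good) R
    φ-T : ∀ xs → φ (⟦ targetExp T ⟧ R xs) ≡ ⟦ targetExp T ⟧ R (map φ xs)
    φ-T xs = trans (cong φ (sym (t-computes-T xs))) (trans (term-preserved φ φ-g t xs) (t-computes-T (map φ xs)))

  module _ {k : ℕ} (c : Vec Bool k → Bool) {φ : Carrier → Carrier} (φ-bij : Bij φ)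
           (φ-M : Preserves R (median R) φ) where
    private
      a = φ 𝟘
      ψ : Carrier → Carrier
      ψ x = φ x + a
      ψ-automorphism : IsHomomorphism R R ψ
      ψ-automorphism = proj₁ (median-preserving⇒translate-automorphism φ-bij φ-M)
      ψ-bij : Bij ψ
      ψ-bij = proj₂ (median-preserving⇒translate-automorphism φ-bij φ-M)
      φ-as-ψ : ∀ (xs : Vec Carrier k) → map φ xs ≡ map (_+ a) (map ψ xs)
      φ-as-ψ xs = trans (V.map-cong (λ x → sym (+-cancel (φ x) a)) xs) (V.map-∘ (_+ a) ψ xs)

    translation-covariant : Preserves R (termFun R c) φ →
      ∀ (ys : Vec Carrier k) → termFun R c (map (_+ a) ys) ≡ termFun R c ys + a
    translation-covariant φ-f ys = begin
      termFun R c (map (_+ a) ys)            ≡⟨ cong (λ zs → termFun R c (map (_+ a) zs)) (sym ψxs≡ys) ⟩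
      termFun R c (map (_+ a) (map ψ xs))    ≡⟨ cong (termFun R c) (sym (φ-as-ψ xs)) ⟩
      termFun R c (map φ xs)                 ≡⟨ sym (φ-f xs) ⟩
      φ (termFun R c xs)                     ≡⟨ sym (+-cancel _ a) ⟩
      ψ (termFun R c xs) + a                 ≡⟨ cong (_+ a) (Homomorphism.hom-termFun ψ-automorphism c xs) ⟩
      termFun R c (map ψ xs) + a             ≡⟨ cong (λ zs → termFun R c zs + a) ψxs≡ys ⟩
      termFun R c ys + a                     ∎
      where
      open ≡-Reasoning
      xs = map (preimage ψ-bij) ys
      ψxs≡ys : map ψ xs ≡ ys
      ψxs≡ys = trans (sym (V.map-∘ ψ _ ys)) (trans (V.map-cong (φ-preimage ψ-bij) ys) (V.map-id ys))

    self-dual⇒f-preserving : SelfDual c → Preserves R (termFun R c) φ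
    self-dual⇒f-preserving self-dual xs = begin
      φ (termFun R c xs)                     ≡⟨ sym (+-cancel _ a) ⟩
      ψ (termFun R c xs) + a                 ≡⟨ cong (_+ a) (Homomorphism.hom-termFun ψ-automorphism c xs) ⟩
      termFun R c (map ψ xs) + a             ≡⟨ sym (self-dual⇒translation-covariant c self-dual R a (map ψ xs)) ⟩
      termFun R c (map (_+ a) (map ψ xs))    ≡⟨ cong (termFun R c) (sym (φ-as-ψ xs)) ⟩
      termFun R c (map φ xs)                 ∎
      where open ≡-Reasoning

    -- Non-self-dual case: preserving f and M forces φ 𝟘 = 𝟘, so φ = ψ.
    non-self-dual⇒automorphism : ∀ bs → termFun 𝔹 c (map not bs) ≡ termFun 𝔹 c bs →
      Preserves R (termFun R c) φ → IsHomomorphism R R φ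
    non-self-dual⇒automorphism bs f¬b≡fb φ-f = endomorphism-ext φ≗ψ ψ-automorphism
      where
      E = map (λ b → eval R b []) bs
      u≡u+a : termFun R c E ≡ termFun R c E + a
      u≡u+a = trans (sym (non-self-dual⇒translation-invariant c bs f¬b≡fb R a)) (translation-covariant φ-f E)
      a≡𝟘 : a ≡ 𝟘
      a≡𝟘 = begin
        a                               ≡⟨ sym (+-identityˡ a) ⟩
        𝟘 + a                           ≡⟨ cong (_+ a) (sym (+-self u)) ⟩
        (u + u) + a                     ≡⟨ +-assoc u u a ⟩
        u + (u + a)                     ≡⟨ cong (u +_) (sym u≡u+a) ⟩
        u + u                           ≡⟨ +-self u ⟩
        𝟘                               ∎
        where
        open ≡-Reasoning
        u = termFun R c E
      φ≗ψ : ∀ x → φ x ≡ ψ x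
      φ≗ψ x = sym (trans (cong (φ x +_) a≡𝟘) (+-identityʳ (φ x)))

-- Main theorem.
lemma2p5 : (R : BooleanRing) → Nontrivial R → Countable R → Atomless R →
    (k : ℕ) (c : Vec Bool k → Bool) → NonLinear R c →
    AutEq R (Preserves R (termFun R c)) (IsAutomorphism R)
    ⊎ AutEq R (Preserves R (termFun R c)) (Preserves R (median R))
lemma2p5 R _ _ _ k c nonlinear with self-dual-or-not c
... | inj₁ self-dual = inj₂ λ φ φ-bij →
      nonlinear⇒median-preserving c nonlinear φ-bij
    , λ φ-M → self-dual⇒f-preserving c φ-bij φ-M self-dual
  where open MainArgument R
... | inj₂ (bs , f¬b≡fb) = inj₁ λ φ φ-bij →
      (λ φ-f → endomorphism⇒automorphism (non-self-dual⇒automorphism c φ-bij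
                 (nonlinear⇒median-preserving c nonlinear φ-bij φ-f) bs f¬b≡fb φ-f))
    , (λ φ-aut → Homomorphism.hom-termFun (automorphism⇒endomorphism φ-aut) c)
  where open MainArgument R
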